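{- Let $r\ge 1$ be an integer. Then \[ \sum_{P} x^{\mathrm{slr}(P)}\, z^{|P|} \;=\; z^r\, x\, C(r)\prod_{h=1}^{r-1}\bigl(1+x(A(h)-1)\bigr), \] where the sum runs over all Dyck paths $P$ of height exactly $r$, $|P|$ denotes the length (number of steps) of $P$, and $\mathrm{slr}(P)$ is the number of strict left to right maxima of $P$.
   Context: A Dyck path of semi-length $n$ is a lattice path from $(0,0)$ to $(2n,0)$ consisting of $n$ up steps $u=(1,1)$ and $n$ down steps $d=(1,-1)$ that never goes below the $x$-axis; its length is $2n$ and its height is the maximal $y$-coordinate attained. A peak is an occurrence of an up step immediately followed by a down step; its height is the height of its top point. A strict left to right maximum is a peak whose height is strictly greater than the heights of all peaks (equivalently, all points) to its left. Put $\lambda_1=\frac{1+\sqrt{1-4z^2}}{2}$, $\lambda_2=\frac{1-\sqrt{1-4z^2}}{2}$, and for integers $h\ge 0$ \[ C(h)=\frac{z^h\sqrt{1-4z^2}}{\lambda_1^{h+2}-\lambda_2^{h+2}},\qquad A(h)=\frac{\lambda_1^{h+1}-\lambda_2^{h+1}}{\lambda_1^{h+2}-\lambda_2^{h+2}}, \] regarded as power series in $z$ (here $A(h)$ is the generating function, by length, of Dyck paths of height at most $h$, and $C(h)$ that of paths with up and down steps staying in $0\le y\le h$, starting at $0$ and ending at height $h$). The identity is one of formal power series in $z$ with coefficients polynomial in $x$. -}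

module Defs where

open import Data.Bool using (Bool; true; false; if_then_else_; _∧_)
open import Data.Nat as ℕ using (ℕ; zero; suc; _∸_; _⊔_; _<ᵇ_; _≡ᵇ_)
open import Data.Integer as ℤ using (ℤ; +_)
open import Data.List using (List; []; _∷_; length; filter; map; _++_)
open import Data.Vec as V using (Vec; []; _∷_)
open import Relation.Binary.PropositionalEquality using (_≡_)
open import Relation.Nullary.Decidable using (Dec)
open import Data.Bool using (T)
open import Relation.Nullary.Decidable using (yes; no)
open import Data.Bool.Properties using (T?)

data Step : Set where
  u d : Step

words : ℕ → List (List Step)
words zero = [] ∷ []
words (suc n) = map (u ∷_) (words n) ++ map (d ∷_) (words n)

dyckFrom : ℕ → List Step → Bool
dyckFrom h [] = h ≡ᵇ 0
dyckFrom h (u ∷ s) = dyckFrom (suc h) s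
dyckFrom zero (d ∷ s) = false
dyckFrom (suc h) (d ∷ s) = dyckFrom h s

isDyck : List Step → Bool
isDyck = dyckFrom 0

maxFrom : ℕ → List Step → ℕ
maxFrom h [] = h
maxFrom h (u ∷ s) = h ⊔ maxFrom (suc h) s
maxFrom h (d ∷ s) = h ⊔ maxFrom (h ∸ 1) s

height : List Step → ℕ
height = maxFrom 0

-- number of strict left-to-right maxima among the peaks.
-- h = current height, m = maximal height of the peaks seen so far
-- (0 if none; every peak has height ≥ 1).
slrFrom : ℕ → ℕ → List Step → ℕ
slrFrom h m [] = 0
slrFrom h m (u ∷ d ∷ s) =
  if m <ᵇ suc h then suc (slrFrom (suc h) (suc h) (d ∷ s))
                else slrFrom (suc h) m (d ∷ s)
slrFrom h m (u ∷ s) = slrFrom (suc h) m s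
slrFrom h m (d ∷ s) = slrFrom (h ∸ 1) m s

slr : List Step → ℕ
slr = slrFrom 0 0

ZSeries : Set
ZSeries = ℕ → ℤ

-- bivariate series in x, z : coefficient of x^i z^n is  f i n
XZSeries : Set
XZSeries = ℕ → ℕ → ℤ

sumTo : ℕ → (ℕ → ℤ) → ℤ
sumTo zero f = f 0
sumTo (suc n) f = sumTo n f ℤ.+ f (suc n)

_*z_ : ZSeries → ZSeries → ZSeries
(f *z g) n = sumTo n (λ k → f k ℤ.* g (n ∸ k))

-- j-th entry of a vector (0 outside the range)
lk : ∀ {m} → Vec ℤ m → ℕ → ℤ
lk [] _ = + 0
lk (x ∷ xs) zero = x
lk (x ∷ xs) (suc j) = lk xs j

-- multiplicative inverse of a z-series with constant term 1:
-- g_0 = 1,  g_{n+1} = - Σ_{k=1}^{n+1} f_k g_{n+1-k}.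
-- invVec f n = (g_n , g_{n-1} , … , g_0)
invVec : ZSeries → (n : ℕ) → Vec ℤ (suc n)
invVec f zero = + 1 ∷ []
invVec f (suc n) =
  ℤ.- sumTo n (λ j → f (suc j) ℤ.* lk (invVec f n) j) ∷ invVec f n

invZ : ZSeries → ZSeries
invZ f n = lk (invVec f n) 0

zPow : ℕ → ZSeries
zPow k n = if n ≡ᵇ k then + 1 else + 0

-- F k = (λ₁^k - λ₂^k)/(λ₁ - λ₂) : F 0 = 0, F 1 = 1, F (k+2) = F (k+1) - z² F k
-- (since λ₁,λ₂ are the roots of λ² = λ - z²); these are polynomials in z.
F : ℕ → ZSeries
F zero n = + 0
F (suc zero) n = zPow 0 n
F (suc (suc k)) n = F (suc k) n ℤ.- (zPow 2 *z F k) n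

-- λ₁ - λ₂ = √(1-4z²), hence
-- A(h) = (λ₁^{h+1}-λ₂^{h+1})/(λ₁^{h+2}-λ₂^{h+2}) = F(h+1)/F(h+2)
-- C(h) = z^h √(1-4z²)/(λ₁^{h+2}-λ₂^{h+2}) = z^h / F(h+2)
A : ℕ → ZSeries
A h = F (suc h) *z invZ (F (suc (suc h)))

C : ℕ → ZSeries
C h = zPow h *z invZ (F (suc (suc h)))

_*xz_ : XZSeries → XZSeries → XZSeries
(f *xz g) i n = sumTo i (λ a → sumTo n (λ b → f a b ℤ.* g (i ∸ a) (n ∸ b)))

_+xz_ : XZSeries → XZSeries → XZSeries
(f +xz g) i n = f i n ℤ.+ g i n

lift : ZSeries → XZSeries
lift f i n = if i ≡ᵇ 0 then f n else + 0

oneXZ : XZSeries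
oneXZ = lift (zPow 0)

xXZ : XZSeries
xXZ i n = if (i ≡ᵇ 1) ∧ (n ≡ᵇ 0) then + 1 else + 0

negXZ : XZSeries → XZSeries
negXZ f i n = ℤ.- f i n

prodFrom : ℕ → ℕ → (ℕ → XZSeries) → XZSeries
prodFrom a zero f = oneXZ
prodFrom a (suc k) f = f a *xz prodFrom (suc a) k f

slrGF : ℕ → XZSeries
slrGF r i n = + length (filter (λ P → T? (isDyck P ∧ (height P ≡ᵇ r) ∧ (slr P ≡ᵇ i))) (words n))

rhsGF : ℕ → XZSeries
rhsGF r = lift (zPow r) *xz (xXZ *xz (lift (C r) *xz
          prodFrom 1 (r ∸ 1) (λ h → oneXZ +xz (xXZ *xz (lift (A h) +xz negXZ oneXZ)))))

-- Cut a Dyck path of height r at its first visits to the heights 1, …, r. Right after first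
-- reaching a height h < r the path either goes up at once, or goes down: then its peak at h is a new
-- strict left-to-right maximum, and the path wanders inside the strip [0, h] from h − 1 back to h
-- before going up. Since A(h) − 1 is z times the generating function of these strip walks, height h
-- contributes z (1 + x (A(h) − 1)). At height r the path makes its last record peak and ends with a
-- walk inside [0, r] from r − 1 down to 0; by the reflection of the strip, z times these walks is
-- C(r). The strip walk series W_a(h → a) solve the first-step equations of walks in [0, a], whose
-- solution is z^(a−h) F(h+1) / F(a+2) with F(k) = (λ₁^k − λ₂^k)/(λ₁ − λ₂); the cases h = a and
-- h = 0 are A(a) and C(a).

module Submission where

open import Defs
open import Data.Nat using (ℕ; _≥_)
open import Relation.Binary.PropositionalEquality using (_≡_)

open import Algebra.Bundles using (CommutativeRing)
open import Algebra.Structures using (IsCommutativeRing)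
import Algebra.Construct.Pointwise as Pointwise
import Algebra.Properties.AbelianGroup as AbelianGroupProperties
import Algebra.Properties.CommutativeSemigroup as CommutativeSemigroupProperties
import Algebra.Properties.Group as GroupProperties
import Algebra.Solver.Ring.NaturalCoefficients.Default as NaturalCoefficientSolver
open import Data.Bool using (Bool; true; false; if_then_else_; _∧_; T)
open import Data.Bool.Properties using (T?; ∧-zeroʳ)
open import Data.Empty using (⊥-elim)
open import Data.Integer as ℤ using (ℤ; +_)
open import Data.Integer.Properties as ℤ using (+-*-commutativeRing)
open import Data.List using (List; []; _∷_; length; filter; map; _++_)
import Data.List.Properties as List
open import Data.Nat as ℕ using (zero; suc; _∸_; _≤_; _<_; z≤n; _<ᵇ_; _≡ᵇ_; _⊔_)
import Data.Nat.Properties as ℕ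
open import Data.Product using (_×_; _,_; proj₁; proj₂)
open import Data.Sum using (inj₁; inj₂)
open import Relation.Binary.PropositionalEquality as ≡ using (_≢_)
import Relation.Binary.Reasoning.Setoid as SetoidReasoning
open import Relation.Nullary using (Dec; yes; no)

-- Formal power series

module PowerSeries {c ℓ} (R : CommutativeRing c ℓ) where

  open CommutativeRing R
  open SetoidReasoning setoid

  Series : Set c
  Series = ℕ → Carrier

  infix 4 _≋_
  _≋_ : Series → Series → Set ℓ
  f ≋ g = ∀ n → f n ≈ g n

  ∑ : ℕ → (ℕ → Carrier) → Carrier
  ∑ zero f = f 0
  ∑ (suc n) f = ∑ n f + f (suc n)

  infixl 7 _⊛_
  _⊛_ : Series → Series → Series
  (f ⊛ g) n = ∑ n (λ k → f k * g (n ∸ k))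

  ∑-cong-≤ : ∀ n {f g} → (∀ k → k ≤ n → f k ≈ g k) → ∑ n f ≈ ∑ n g
  ∑-cong-≤ zero f≈g = f≈g 0 z≤n
  ∑-cong-≤ (suc n) f≈g =
    +-cong (∑-cong-≤ n (λ k k≤n → f≈g k (ℕ.m≤n⇒m≤1+n k≤n))) (f≈g (suc n) ℕ.≤-refl)

  ∑-cong : ∀ n {f g} → (∀ k → f k ≈ g k) → ∑ n f ≈ ∑ n g
  ∑-cong n f≈g = ∑-cong-≤ n (λ k _ → f≈g k)

  ∑-suc-head : ∀ n f → ∑ (suc n) f ≈ f 0 + ∑ n (λ k → f (suc k))
  ∑-suc-head zero f = refl
  ∑-suc-head (suc n) f = begin
    ∑ (suc n) f + f (suc (suc n))                       ≈⟨ +-congʳ (∑-suc-head n f) ⟩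
    (f 0 + ∑ n (λ k → f (suc k))) + f (suc (suc n))     ≈⟨ +-assoc _ _ _ ⟩
    f 0 + (∑ n (λ k → f (suc k)) + f (suc (suc n)))     ∎

  ∑-distrib-+ : ∀ n f g → ∑ n (λ k → f k + g k) ≈ ∑ n f + ∑ n g
  ∑-distrib-+ zero f g = refl
  ∑-distrib-+ (suc n) f g = begin
    ∑ n (λ k → f k + g k) + (f (suc n) + g (suc n)) ≈⟨ +-congʳ (∑-distrib-+ n f g) ⟩
    (∑ n f + ∑ n g) + (f (suc n) + g (suc n))       ≈⟨ interchange _ _ _ _ ⟩
    (∑ n f + f (suc n)) + (∑ n g + g (suc n))       ∎
    where open CommutativeSemigroupProperties +-commutativeSemigroup using (interchange)

  *-distribˡ-∑ : ∀ n a f → a * ∑ n f ≈ ∑ n (λ k → a * f k)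
  *-distribˡ-∑ zero a f = refl
  *-distribˡ-∑ (suc n) a f = trans (distribˡ _ _ _) (+-congʳ (*-distribˡ-∑ n a f))

  ∑-zero : ∀ n → ∑ n (λ _ → 0#) ≈ 0#
  ∑-zero zero = refl
  ∑-zero (suc n) = trans (+-identityʳ _) (∑-zero n)

  ∑-reverse : ∀ n f → ∑ n f ≈ ∑ n (λ k → f (n ∸ k))
  ∑-reverse zero f = refl
  ∑-reverse (suc n) f = begin
    ∑ n f + f (suc n)                   ≈⟨ +-comm _ _ ⟩
    f (suc n) + ∑ n f                   ≈⟨ +-congˡ (∑-reverse n f) ⟩
    f (suc n) + ∑ n (λ k → f (n ∸ k))   ≈⟨ ∑-suc-head n (λ k → f (suc n ∸ k)) ⟨
    ∑ (suc n) (λ k → f (suc n ∸ k))     ∎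

  0ₛ 1ₛ : Series
  0ₛ _ = 0#
  1ₛ zero = 1#
  1ₛ (suc _) = 0#

  ⊛-suc : ∀ f g n → (f ⊛ g) (suc n) ≈ f 0 * g (suc n) + ((λ k → f (suc k)) ⊛ g) n
  ⊛-suc f g n = ∑-suc-head n (λ k → f k * g (suc n ∸ k))

  ⊛-cong : ∀ {f f′ g g′} → f ≋ f′ → g ≋ g′ → f ⊛ g ≋ f′ ⊛ g′
  ⊛-cong f≋f′ g≋g′ n = ∑-cong n (λ k → *-cong (f≋f′ k) (g≋g′ (n ∸ k)))

  ⊛-distribʳ : ∀ f g h → (λ k → f k + g k) ⊛ h ≋ (λ n → (f ⊛ h) n + (g ⊛ h) n)
  ⊛-distribʳ f g h n = trans (∑-cong n (λ k → distribʳ _ _ _)) (∑-distrib-+ n _ _)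

  ⊛-scaleˡ : ∀ a f g → (λ k → a * f k) ⊛ g ≋ (λ n → a * (f ⊛ g) n)
  ⊛-scaleˡ a f g n = trans (∑-cong n (λ k → *-assoc _ _ _)) (sym (*-distribˡ-∑ n a _))

  ⊛-comm : ∀ f g → f ⊛ g ≋ g ⊛ f
  ⊛-comm f g n = trans (∑-reverse n (λ k → f k * g (n ∸ k))) (∑-cong-≤ n (λ k k≤n →
    trans (*-comm _ _) (*-congʳ (reflexive (≡.cong g (ℕ.m∸[m∸n]≡n k≤n))))))

  ⊛-zeroˡ : ∀ g → 0ₛ ⊛ g ≋ 0ₛ
  ⊛-zeroˡ g n = trans (∑-cong n (λ k → zeroˡ _)) (∑-zero n)

  ⊛-identityˡ : ∀ g → 1ₛ ⊛ g ≋ g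
  ⊛-identityˡ g zero = *-identityˡ _
  ⊛-identityˡ g (suc n) = begin
    (1ₛ ⊛ g) (suc n)             ≈⟨ ⊛-suc 1ₛ g n ⟩
    1# * g (suc n) + (0ₛ ⊛ g) n  ≈⟨ +-cong (*-identityˡ _) (⊛-zeroˡ g n) ⟩
    g (suc n) + 0#               ≈⟨ +-identityʳ _ ⟩
    g (suc n)                    ∎

  ⊛-assoc : ∀ f g h → (f ⊛ g) ⊛ h ≋ f ⊛ (g ⊛ h)
  ⊛-assoc f g h zero = *-assoc _ _ _
  ⊛-assoc f g h (suc n) = begin
    ((f ⊛ g) ⊛ h) (suc n)
      ≈⟨ ⊛-suc (f ⊛ g) h n ⟩
    (f 0 * g 0) * h (suc n) + ((λ k → (f ⊛ g) (suc k)) ⊛ h) n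
      ≈⟨ +-congˡ (⊛-cong {g = h} (⊛-suc f g) (λ _ → refl) n) ⟩
    (f 0 * g 0) * h (suc n) + ((λ k → f 0 * g (suc k) + (f′ ⊛ g) k) ⊛ h) n
      ≈⟨ +-congˡ (⊛-distribʳ _ _ h n) ⟩
    (f 0 * g 0) * h (suc n) + (((λ k → f 0 * g (suc k)) ⊛ h) n + ((f′ ⊛ g) ⊛ h) n)
      ≈⟨ +-congˡ (+-cong (⊛-scaleˡ (f 0) _ h n) (⊛-assoc f′ g h n)) ⟩
    (f 0 * g 0) * h (suc n) + (f 0 * (g′ ⊛ h) n + (f′ ⊛ (g ⊛ h)) n)
      ≈⟨ +-assoc _ _ _ ⟨
    ((f 0 * g 0) * h (suc n) + f 0 * (g′ ⊛ h) n) + (f′ ⊛ (g ⊛ h)) n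
      ≈⟨ +-congʳ (trans (+-congʳ (*-assoc _ _ _)) (sym (distribˡ _ _ _))) ⟩
    f 0 * (g 0 * h (suc n) + (g′ ⊛ h) n) + (f′ ⊛ (g ⊛ h)) n
      ≈⟨ +-congʳ (*-congˡ (⊛-suc g h n)) ⟨
    f 0 * (g ⊛ h) (suc n) + (f′ ⊛ (g ⊛ h)) n
      ≈⟨ ⊛-suc f (g ⊛ h) n ⟨
    (f ⊛ (g ⊛ h)) (suc n) ∎
    where
    f′ g′ : Series
    f′ k = f (suc k)
    g′ k = g (suc k)

  isPowerSeriesRing : IsCommutativeRing _≋_ (λ f g n → f n + g n) _⊛_ (λ f n → - f n) 0ₛ 1ₛ
  isPowerSeriesRing = record
    { isRing = record
      { +-isAbelianGroup = Pointwise.isAbelianGroup ℕ +-isAbelianGroup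
      ; *-cong = ⊛-cong
      ; *-assoc = ⊛-assoc
      ; *-identity = ⊛-identityˡ , λ g n → trans (⊛-comm g 1ₛ n) (⊛-identityˡ g n)
      ; distrib = (λ f g h n → trans (⊛-comm f _ n)
                    (trans (⊛-distribʳ g h f n) (+-cong (⊛-comm g f n) (⊛-comm h f n))))
                , (λ h f g → ⊛-distribʳ f g h)
      }
    ; *-comm = ⊛-comm
    }

  powerSeriesRing : CommutativeRing c ℓ
  powerSeriesRing = record { isCommutativeRing = isPowerSeriesRing }

  const : Carrier → Series
  const a zero = a
  const a (suc _) = 0#

  X : Series
  X zero = 0#
  X (suc k) = 1ₛ k

  const-⊛ : ∀ a g → const a ⊛ g ≋ (λ n → a * g n)
  const-⊛ a g zero = refl
  const-⊛ a g (suc n) = begin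
    (const a ⊛ g) (suc n)          ≈⟨ ⊛-suc (const a) g n ⟩
    a * g (suc n) + (0ₛ ⊛ g) n     ≈⟨ +-congˡ (⊛-zeroˡ g n) ⟩
    a * g (suc n) + 0#             ≈⟨ +-identityʳ _ ⟩
    a * g (suc n)                  ∎

  X⊛-zero : ∀ g → (X ⊛ g) 0 ≈ 0#
  X⊛-zero g = zeroˡ _

  X⊛-suc : ∀ g n → (X ⊛ g) (suc n) ≈ g n
  X⊛-suc g n = begin
    (X ⊛ g) (suc n)              ≈⟨ ⊛-suc X g n ⟩
    0# * g (suc n) + (1ₛ ⊛ g) n  ≈⟨ +-cong (zeroˡ _) (⊛-identityˡ g n) ⟩
    0# + g n                     ≈⟨ +-identityˡ _ ⟩
    g n                          ∎

  const-cong : ∀ {a b} → a ≈ b → const a ≋ const b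
  const-cong a≈b zero = a≈b
  const-cong a≈b (suc n) = refl

  const-+ : ∀ a b → const (a + b) ≋ (λ n → const a n + const b n)
  const-+ a b zero = refl
  const-+ a b (suc n) = sym (+-identityʳ _)

  const-* : ∀ a b → const (a * b) ≋ const a ⊛ const b
  const-* a b zero = refl
  const-* a b (suc n) = sym (trans (const-⊛ a (const b) (suc n)) (zeroʳ _))

  const-0 : const 0# ≋ 0ₛ
  const-0 zero = refl
  const-0 (suc n) = refl

  const-1 : const 1# ≋ 1ₛ
  const-1 zero = refl
  const-1 (suc n) = refl

open ≡ using (refl; cong; cong₂)

-- Equality of series is coefficientwise and unification cannot see through integer arithmetic, so
-- series arguments of the ring laws below are often supplied explicitly.
ℤ⟦z⟧ : CommutativeRing _ _
ℤ⟦z⟧ = PowerSeries.powerSeriesRing +-*-commutativeRing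

-- The outer index is the exponent of x, so f i n is the coefficient of x^i z^n.
ℤ⟦x,z⟧ : CommutativeRing _ _
ℤ⟦x,z⟧ = PowerSeries.powerSeriesRing ℤ⟦z⟧

module Z = CommutativeRing ℤ⟦z⟧
module Zₛ = PowerSeries +-*-commutativeRing
module XZ = CommutativeRing ℤ⟦x,z⟧
module XZₛ = PowerSeries ℤ⟦z⟧

𝕫 : ZSeries
𝕫 = Zₛ.X

𝕩 : XZSeries
𝕩 = XZₛ.X

↑ : ZSeries → XZSeries
↑ = XZₛ.const

↑𝕫*-zero : ∀ G i → (↑ 𝕫 XZ.* G) i 0 ≡ + 0
↑𝕫*-zero G i = ≡.trans (XZₛ.const-⊛ 𝕫 G i 0) (Zₛ.X⊛-zero (G i))

↑𝕫*-suc : ∀ G i n → (↑ 𝕫 XZ.* G) i (suc n) ≡ G i n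
↑𝕫*-suc G i n = ≡.trans (XZₛ.const-⊛ 𝕫 G i (suc n)) (Zₛ.X⊛-suc (G i) n)

sumTo≡∑ : ∀ n f → sumTo n f ≡ Zₛ.∑ n f
sumTo≡∑ zero f = refl
sumTo≡∑ (suc n) f = cong (ℤ._+ f (suc n)) (sumTo≡∑ n f)

*z≈* : ∀ f g → f *z g Z.≈ f Z.* g
*z≈* f g n = sumTo≡∑ n _

∑-coefficient : ∀ i H n → XZₛ.∑ i H n ≡ Zₛ.∑ i (λ a → H a n)
∑-coefficient zero H n = refl
∑-coefficient (suc i) H n = cong (ℤ._+ H (suc i) n) (∑-coefficient i H n)

*xz≈* : ∀ f g → f *xz g XZ.≈ f XZ.* g
*xz≈* f g i n = ≡.trans (sumTo≡∑ i _)
  (≡.trans (Zₛ.∑-cong i (λ a → sumTo≡∑ n _)) (≡.sym (∑-coefficient i _ n)))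

*xz-cong : ∀ {f f′ g g′} → f XZ.≈ f′ → g XZ.≈ g′ → f *xz g XZ.≈ f′ XZ.* g′
*xz-cong {f} {f′} {g} {g′} f≈f′ g≈g′ = XZ.trans {f *xz g} (*xz≈* f g) (XZ.*-cong {f} {f′} {g} {g′} f≈f′ g≈g′)

lift≈↑ : ∀ f → lift f XZ.≈ ↑ f
lift≈↑ f zero n = refl
lift≈↑ f (suc i) n = refl

zPow-zero : zPow 0 Z.≈ Z.1#
zPow-zero zero = refl
zPow-zero (suc n) = refl

zPow-suc : ∀ k → zPow (suc k) Z.≈ 𝕫 Z.* zPow k
zPow-suc k zero = ≡.sym (Zₛ.X⊛-zero (zPow k))
zPow-suc k (suc n) = ≡.sym (Zₛ.X⊛-suc (zPow k) n)

zPow-one : zPow 1 Z.≈ 𝕫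
zPow-one zero = refl
zPow-one (suc zero) = refl
zPow-one (suc (suc n)) = refl

oneXZ≈1 : oneXZ XZ.≈ XZ.1#
oneXZ≈1 zero n = zPow-zero n
oneXZ≈1 (suc i) n = refl

xXZ≈𝕩 : xXZ XZ.≈ 𝕩
xXZ≈𝕩 zero zero = refl
xXZ≈𝕩 zero (suc n) = refl
xXZ≈𝕩 (suc zero) zero = refl
xXZ≈𝕩 (suc zero) (suc n) = refl
xXZ≈𝕩 (suc (suc i)) zero = refl
xXZ≈𝕩 (suc (suc i)) (suc n) = refl

lk-invVec : ∀ f n j → j ≤ n → lk (invVec f n) j ≡ invZ f (n ∸ j)
lk-invVec f zero zero _ = refl
lk-invVec f (suc n) zero _ = refl
lk-invVec f (suc n) (suc j) (ℕ.s≤s j≤n) = lk-invVec f n j j≤n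

*-invZ : ∀ f → f 0 ≡ + 1 → f Z.* invZ f Z.≈ Z.1#
*-invZ f f₀≡1 zero rewrite f₀≡1 = refl
*-invZ f f₀≡1 (suc n) = begin
  (f Z.* invZ f) (suc n)
    ≡⟨ Zₛ.⊛-suc f (invZ f) n ⟩
  f 0 ℤ.* invZ f (suc n) ℤ.+ S
    ≡⟨ cong (λ c → c ℤ.* invZ f (suc n) ℤ.+ S) f₀≡1 ⟩
  + 1 ℤ.* ℤ.- sumTo n (λ j → f (suc j) ℤ.* lk (invVec f n) j) ℤ.+ S
    ≡⟨ cong (ℤ._+ S) (≡.trans (ℤ.*-identityˡ _) (cong ℤ.-_ (≡.trans (sumTo≡∑ n _)
         (Zₛ.∑-cong-≤ n (λ j j≤n → cong (f (suc j) ℤ.*_) (lk-invVec f n j j≤n)))))) ⟩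
  ℤ.- S ℤ.+ S
    ≡⟨ ℤ.+-inverseˡ S ⟩
  + 0 ∎
  where
  open ≡.≡-Reasoning
  S = ((λ k → f (suc k)) Z.* invZ f) n

*-cancel-invZ : ∀ f h p → f 0 ≡ + 1 → f Z.* h Z.≈ p → h Z.≈ p Z.* invZ f
*-cancel-invZ f h p f₀≡1 fh≈p = begin
  h                        ≈⟨ Z.*-identityʳ h ⟨
  h Z.* Z.1#               ≈⟨ Z.*-congˡ {h} (*-invZ f f₀≡1) ⟨
  h Z.* (f Z.* invZ f)     ≈⟨ Z.*-assoc h f (invZ f) ⟨
  (h Z.* f) Z.* invZ f     ≈⟨ Z.*-congʳ {invZ f} (Z.*-comm h f) ⟩
  (f Z.* h) Z.* invZ f     ≈⟨ Z.*-congʳ {invZ f} fh≈p ⟩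
  p Z.* invZ f             ∎
  where open SetoidReasoning Z.setoid

F-constant : ∀ k → F (suc k) 0 ≡ + 1
F-constant zero = refl
F-constant (suc k) rewrite F-constant k | ℤ.*-zeroˡ (F k 0) = refl

F-rec : ∀ k → F (suc (suc k)) Z.≈ F (suc k) Z.- 𝕫 Z.* 𝕫 Z.* F k
F-rec k n = cong (λ t → F (suc k) n ℤ.+ ℤ.- t)
  (≡.trans (*z≈* (zPow 2) (F k) n) (Z.*-congʳ {F k} (Z.trans {zPow 2} (zPow-suc 1) (Z.*-congˡ {𝕫} zPow-one)) n))

F-step : ∀ t → F (suc t) Z.≈ F (suc (suc t)) Z.+ 𝕫 Z.* 𝕫 Z.* F t
F-step t = Z.trans {F (suc t)} (Z.sym {(F (suc t) Z.- w) Z.+ w} (//-rightDividesˡ w (F (suc t))))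
                              (Z.+-congʳ {w} (Z.sym {F (suc (suc t))} (F-rec t)))
  where
  open GroupProperties Z.+-group using (//-rightDividesˡ)
  w = 𝕫 Z.* 𝕫 Z.* F t

-- Walks in a strip

≡ᵇ-refl : ∀ x → (x ≡ᵇ x) ≡ true
≡ᵇ-refl x with x ≡ᵇ x | ℕ.≡⇒≡ᵇ x x refl
... | true | _ = refl

≡ᵇ-≢ : ∀ {x y} → x ≢ y → (x ≡ᵇ y) ≡ false
≡ᵇ-≢ {x} {y} x≢y with x ≡ᵇ y | ℕ.≡ᵇ⇒≡ x y
... | true | x≡y = ⊥-elim (x≢y (x≡y _))
... | false | _ = refl

δ : ℕ → ℕ → ℤ
δ h k = if h ≡ᵇ k then + 1 else + 0

δ-refl : ∀ h → δ h h ≡ + 1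
δ-refl h rewrite ≡ᵇ-refl h = refl

δ-≢ : ∀ {h k} → h ≢ k → δ h k ≡ + 0
δ-≢ h≢k rewrite ≡ᵇ-≢ h≢k = refl

up : ℕ → (ℕ → ℤ) → ℕ → ℤ
up a g h = if h <ᵇ a then g (suc h) else + 0

down : (ℕ → ℤ) → ℕ → ℤ
down g zero = + 0
down g (suc h) = g h

neighbours : ℕ → (ℕ → ℤ) → ℕ → ℤ
neighbours a g h = up a g h ℤ.+ down g h

up-< : ∀ {a h} g → h < a → up a g h ≡ g (suc h)
up-< {a} {h} g h<a with h <ᵇ a | ℕ.<⇒<ᵇ h<a
... | true | _ = refl

up-≥ : ∀ {a h} g → a ≤ h → up a g h ≡ + 0
up-≥ {a} {h} g a≤h with h <ᵇ a | ℕ.<ᵇ⇒< h a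
... | true | h<a = ⊥-elim (ℕ.≤⇒≯ a≤h (h<a _))
... | false | _ = refl

neighbours-cong-≤ : ∀ {a g g′ h} → (∀ h′ → h′ ≤ a → g h′ ≡ g′ h′) → h ≤ a →
                    neighbours a g h ≡ neighbours a g′ h
neighbours-cong-≤ {a} {g} {g′} {h} g≡g′ h≤a = cong₂ ℤ._+_ up-cong (down-cong h h≤a)
  where
  up-cong : up a g h ≡ up a g′ h
  up-cong with h <ᵇ a | ℕ.<ᵇ⇒< h a
  ... | true | h<a = g≡g′ (suc h) (h<a _)
  ... | false | _ = refl
  down-cong : ∀ h → h ≤ a → down g h ≡ down g′ h
  down-cong zero _ = refl
  down-cong (suc h) h<a = g≡g′ h (ℕ.<⇒≤ h<a)

-- walks a k n h is the number of ±1 walks of length n from h to k inside [0, a].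
walks : ℕ → ℕ → ℕ → ℕ → ℤ
walks a k zero h = δ h k
walks a k (suc n) h = neighbours a (walks a k n) h

W : ℕ → ℕ → ℕ → ZSeries
W a h k n = walks a k n h

StripSystem : ℕ → ℕ → ZSeries → (ℕ → ZSeries) → Set
StripSystem a k b X = ∀ h → h ≤ a →
  X h 0 ≡ δ h k ℤ.* b 0 ×
  (∀ n → X h (suc n) ≡ δ h k ℤ.* b (suc n) ℤ.+ neighbours a (λ h′ → X h′ n) h)

StripSystem-unique : ∀ {a k b X Y} → StripSystem a k b X → StripSystem a k b Y →
                     ∀ n h → h ≤ a → X h n ≡ Y h n
StripSystem-unique X-sol Y-sol zero h h≤a = ≡.trans (proj₁ (X-sol h h≤a)) (≡.sym (proj₁ (Y-sol h h≤a)))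
StripSystem-unique {k = k} {b} X-sol Y-sol (suc n) h h≤a =
  ≡.trans (proj₂ (X-sol h h≤a) n)
    (≡.trans (cong (ℤ._+_ (δ h k ℤ.* b (suc n))) (neighbours-cong-≤ (StripSystem-unique {b = b} X-sol Y-sol n) h≤a))
      (≡.sym (proj₂ (Y-sol h h≤a) n)))

W-solves : ∀ a k b → StripSystem a k b (λ h → W a h k Z.* b)
W-solves a k b h _ = refl , first-step
  where
  up-⊛ : ∀ h n → ((λ m → up a (walks a k m) h) Z.* b) n ≡ up a (λ h′ → (W a h′ k Z.* b) n) h
  up-⊛ h n with h <ᵇ a
  ... | true = refl
  ... | false = Zₛ.⊛-zeroˡ b n
  down-⊛ : ∀ h n → ((λ m → down (walks a k m) h) Z.* b) n ≡ down (λ h′ → (W a h′ k Z.* b) n) h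
  down-⊛ zero n = Zₛ.⊛-zeroˡ b n
  down-⊛ (suc h) n = refl
  first-step : ∀ n → (W a h k Z.* b) (suc n) ≡
               δ h k ℤ.* b (suc n) ℤ.+ neighbours a (λ h′ → (W a h′ k Z.* b) n) h
  first-step n = ≡.trans (Zₛ.⊛-suc (W a h k) b n) (cong (ℤ._+_ (δ h k ℤ.* b (suc n)))
    (≡.trans (Zₛ.⊛-distribʳ (λ m → up a (walks a k m) h) (λ m → down (walks a k m) h) b n)
      (cong₂ ℤ._+_ (up-⊛ h n) (down-⊛ h n))))

StripSystem⇒W : ∀ {a k b X} → StripSystem a k b X → ∀ h → h ≤ a → X h Z.≈ W a h k Z.* b
StripSystem⇒W {a} {k} {b} X-sol h h≤a n = StripSystem-unique {b = b} X-sol (W-solves a k b) n h h≤a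

StripSystemₛ : ℕ → ℕ → ZSeries → (ℕ → ZSeries) → Set
StripSystemₛ a k b X = ∀ h → h ≤ a →
  X h Z.≈ (λ n → δ h k ℤ.* b n) Z.+ 𝕫 Z.* (λ n → neighbours a (λ h′ → X h′ n) h)

StripSystemₛ⇒StripSystem : ∀ {a k b X} → StripSystemₛ a k b X → StripSystem a k b X
StripSystemₛ⇒StripSystem {a} {k} {b} {X} X-sol h h≤a =
  ≡.trans (X-sol h h≤a 0)
    (≡.trans (cong (ℤ._+_ (δ h k ℤ.* b 0)) (Zₛ.X⊛-zero N)) (ℤ.+-identityʳ _)) ,
  λ n → ≡.trans (X-sol h h≤a (suc n)) (cong (ℤ._+_ (δ h k ℤ.* b (suc n))) (Zₛ.X⊛-suc N n))
  where
  N : ZSeries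
  N n = neighbours a (λ h′ → X h′ n) h

δ-scale-refl : ∀ h b → (λ n → δ h h ℤ.* b n) Z.≈ b
δ-scale-refl h b n = ≡.trans (cong (ℤ._* b n) (δ-refl h)) (ℤ.*-identityˡ (b n))

δ-scale-≢ : ∀ {h k} (b : ZSeries) → h ≢ k → (λ n → δ h k ℤ.* b n) Z.≈ Z.0#
δ-scale-≢ {h} {k} b h≢k n = ≡.trans (cong (ℤ._* b n) (δ-≢ {h} {k} h≢k)) (ℤ.*-zeroˡ (b n))

∸-suc : ∀ {h a} → h < a → a ∸ h ≡ suc (a ∸ suc h)
∸-suc {zero} {suc a} _ = refl
∸-suc {suc h} {suc a} (ℕ.s≤s h<a) = ∸-suc h<a

zPow-cong : ∀ {m k} → m ≡ k → zPow m Z.≈ zPow k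
zPow-cong refl n = refl

module ZSolver = NaturalCoefficientSolver Z.commutativeSemiring

zPow-*-F-step : ∀ e t →
  zPow (suc e) Z.* F (suc t) Z.≈ 𝕫 Z.* (zPow e Z.* F (suc (suc t)) Z.+ zPow (suc (suc e)) Z.* F t)
zPow-*-F-step e t = begin
  zPow (suc e) Z.* F (suc t)
    ≈⟨ Z.*-cong {zPow (suc e)} (zPow-suc e) (F-step t) ⟩
  (𝕫 Z.* p) Z.* (F (suc (suc t)) Z.+ 𝕫 Z.* 𝕫 Z.* F t)
    ≈⟨ solve 4 (λ z p q f → (z :* p) :* (q :+ z :* z :* f) := z :* (p :* q :+ (z :* (z :* p)) :* f))
         Z.refl 𝕫 p (F (suc (suc t))) (F t) ⟩
  𝕫 Z.* (p Z.* F (suc (suc t)) Z.+ (𝕫 Z.* (𝕫 Z.* p)) Z.* F t)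
    ≈⟨ Z.*-congˡ {𝕫} (Z.+-congˡ {p Z.* F (suc (suc t))} (Z.*-congʳ {F t}
         (Z.trans {zPow (suc (suc e))} (zPow-suc (suc e)) (Z.*-congˡ {𝕫} (zPow-suc e))))) ⟨
  𝕫 Z.* (p Z.* F (suc (suc t)) Z.+ zPow (suc (suc e)) Z.* F t) ∎
  where
  open SetoidReasoning Z.setoid
  open ZSolver
  p = zPow e

module _ (a : ℕ) where

  private
    G : ℕ → ZSeries
    G h = zPow (a ∸ h) Z.* F (suc h)

    Up Down : ℕ → ZSeries
    Up h n = up a (λ h′ → G h′ n) h
    Down h n = down (λ h′ → G h′ n) h

    Down-G : ∀ h → Down h Z.≈ zPow (suc a ∸ h) Z.* F h
    Down-G zero n = ≡.sym (Z.zeroʳ (zPow (suc a)) n)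
    Down-G (suc h) n = refl

    G-below-top : ∀ {h} → h < a →
      G h Z.≈ (λ n → δ h a ℤ.* F (suc (suc a)) n) Z.+ 𝕫 Z.* (Up h Z.+ Down h)
    G-below-top {h} h<a = begin
      G h
        ≈⟨ Z.*-congʳ {F (suc h)} (zPow-cong (∸-suc h<a)) ⟩
      zPow (suc e) Z.* F (suc h)
        ≈⟨ zPow-*-F-step e h ⟩
      𝕫 Z.* (zPow e Z.* F (suc (suc h)) Z.+ zPow (suc (suc e)) Z.* F h)
        ≈⟨ Z.*-congˡ {𝕫} (Z.+-cong {Up h} (λ n → up-< (λ h′ → G h′ n) h<a)
             (Z.trans {Down h} (Down-G h) (Z.*-congʳ {F h} (zPow-cong suc-a∸h)))) ⟨
      𝕫 Z.* (Up h Z.+ Down h)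
        ≈⟨ Z.+-identityˡ _ ⟨
      Z.0# Z.+ 𝕫 Z.* (Up h Z.+ Down h)
        ≈⟨ Z.+-congʳ {𝕫 Z.* (Up h Z.+ Down h)} (δ-scale-≢ (F (suc (suc a))) (ℕ.<⇒≢ h<a)) ⟨
      (λ n → δ h a ℤ.* F (suc (suc a)) n) Z.+ 𝕫 Z.* (Up h Z.+ Down h) ∎
      where
      open SetoidReasoning Z.setoid
      e = a ∸ suc h
      suc-a∸h : suc a ∸ h ≡ suc (suc e)
      suc-a∸h = ≡.trans (ℕ.+-∸-assoc 1 (ℕ.<⇒≤ h<a)) (cong suc (∸-suc h<a))

    G-top : G a Z.≈ (λ n → δ a a ℤ.* F (suc (suc a)) n) Z.+ 𝕫 Z.* (Up a Z.+ Down a)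
    G-top = begin
      G a
        ≈⟨ Z.*-congʳ {F (suc a)} (Z.trans {zPow (a ∸ a)} (zPow-cong (ℕ.n∸n≡0 a)) zPow-zero) ⟩
      Z.1# Z.* F (suc a)
        ≈⟨ Z.*-identityˡ (F (suc a)) ⟩
      F (suc a)
        ≈⟨ F-step a ⟩
      F (suc (suc a)) Z.+ 𝕫 Z.* 𝕫 Z.* F a
        ≈⟨ Z.+-congˡ {F (suc (suc a))} (Z.*-assoc 𝕫 𝕫 (F a)) ⟩
      F (suc (suc a)) Z.+ 𝕫 Z.* (𝕫 Z.* F a)
        ≈⟨ Z.+-congʳ {𝕫 Z.* (𝕫 Z.* F a)} (δ-scale-refl a (F (suc (suc a)))) ⟨
      (λ n → δ a a ℤ.* F (suc (suc a)) n) Z.+ 𝕫 Z.* (𝕫 Z.* F a)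
        ≈⟨ Z.+-congˡ {λ n → δ a a ℤ.* F (suc (suc a)) n} (Z.*-congˡ {𝕫} neighbours-top) ⟨
      (λ n → δ a a ℤ.* F (suc (suc a)) n) Z.+ 𝕫 Z.* (Up a Z.+ Down a) ∎
      where
      open SetoidReasoning Z.setoid
      neighbours-top : Up a Z.+ Down a Z.≈ 𝕫 Z.* F a
      neighbours-top = begin
        Up a Z.+ Down a
          ≈⟨ Z.+-cong {Up a} (λ n → up-≥ (λ h′ → G h′ n) ℕ.≤-refl)
               (Z.trans {Down a} (Down-G a) (Z.*-congʳ {F a} (zPow-cong (ℕ.m+n∸n≡m 1 a)))) ⟩
        Z.0# Z.+ zPow 1 Z.* F a
          ≈⟨ Z.+-identityˡ _ ⟩
        zPow 1 Z.* F a
          ≈⟨ Z.*-congʳ {F a} zPow-one ⟩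
        𝕫 Z.* F a ∎

    G-solves : StripSystemₛ a a (F (suc (suc a))) G
    G-solves h h≤a with ℕ.m≤n⇒m<n∨m≡n h≤a
    ... | inj₁ h<a = G-below-top h<a
    ... | inj₂ refl = G-top

  W-to-top : ∀ h → h ≤ a → W a h a Z.* F (suc (suc a)) Z.≈ zPow (a ∸ h) Z.* F (suc h)
  W-to-top h h≤a = Z.sym {G h} (StripSystem⇒W {b = F (suc (suc a))} (StripSystemₛ⇒StripSystem G-solves) h h≤a)

A≈W : ∀ a → A a Z.≈ W a a a
A≈W a = Z.sym {W a a a} (Z.trans {W a a a}
  (*-cancel-invZ (F (suc (suc a))) (W a a a) (F (suc a)) (F-constant (suc a)) F*W≈F)
  (Z.sym {A a} (*z≈* (F (suc a)) (invZ (F (suc (suc a)))))))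
  where
  open SetoidReasoning Z.setoid
  F*W≈F : F (suc (suc a)) Z.* W a a a Z.≈ F (suc a)
  F*W≈F = begin
    F (suc (suc a)) Z.* W a a a   ≈⟨ Z.*-comm (F (suc (suc a))) (W a a a) ⟩
    W a a a Z.* F (suc (suc a))   ≈⟨ W-to-top a a ℕ.≤-refl ⟩
    zPow (a ∸ a) Z.* F (suc a)    ≈⟨ Z.*-congʳ {F (suc a)} (Z.trans {zPow (a ∸ a)} (zPow-cong (ℕ.n∸n≡0 a)) zPow-zero) ⟩
    Z.1# Z.* F (suc a)            ≈⟨ Z.*-identityˡ _ ⟩
    F (suc a)                     ∎

C≈W : ∀ a → C a Z.≈ W a 0 a
C≈W a = Z.sym {W a 0 a} (Z.trans {W a 0 a}
  (*-cancel-invZ (F (suc (suc a))) (W a 0 a) (zPow a) (F-constant (suc a)) F*W≈zPow)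
  (Z.sym {C a} (*z≈* (zPow a) (invZ (F (suc (suc a)))))))
  where
  open SetoidReasoning Z.setoid
  F*W≈zPow : F (suc (suc a)) Z.* W a 0 a Z.≈ zPow a
  F*W≈zPow = begin
    F (suc (suc a)) Z.* W a 0 a   ≈⟨ Z.*-comm (F (suc (suc a))) (W a 0 a) ⟩
    W a 0 a Z.* F (suc (suc a))   ≈⟨ W-to-top a 0 z≤n ⟩
    zPow a Z.* F 1                ≈⟨ Z.*-congˡ {zPow a} zPow-zero ⟩
    zPow a Z.* Z.1#               ≈⟨ Z.*-identityʳ _ ⟩
    zPow a                        ∎

δ-reflect : ∀ {a} h h′ k k′ → h ℕ.+ h′ ≡ a → k ℕ.+ k′ ≡ a → δ h k ≡ δ h′ k′
δ-reflect h h′ k k′ hh′ kk′ with h ℕ.≟ k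
... | no h≢k = ≡.trans (δ-≢ h≢k) (≡.sym (δ-≢ {h′} {k′} λ h′≡k′ →
  h≢k (ℕ.+-cancelʳ-≡ h′ h k (≡.trans hh′ (≡.trans (≡.sym kk′) (cong (k ℕ.+_) (≡.sym h′≡k′)))))))
... | yes refl with ℕ.+-cancelˡ-≡ h h′ k′ (≡.trans hh′ (≡.sym kk′))
...   | refl = ≡.trans (δ-refl h) (≡.sym (δ-refl h′))

up≡down-reflect : ∀ a h h′ (g g′ : ℕ → ℤ) → h ℕ.+ h′ ≡ a →
                  (∀ i i′ → i ℕ.+ i′ ≡ a → g i ≡ g′ i′) → up a g h ≡ down g′ h′
up≡down-reflect a h zero g g′ hh′ _ = up-≥ g (ℕ.≤-reflexive (≡.trans (≡.sym hh′) (ℕ.+-identityʳ h)))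
up≡down-reflect a h (suc h′) g g′ hh′ g≡g′ =
  ≡.trans (up-< g (≡.subst (h <_) hh′ (ℕ.m<m+n h ℕ.z<s)))
          (g≡g′ (suc h) h′ (≡.trans (≡.sym (ℕ.+-suc h h′)) hh′))

walks-reflect : ∀ a n h h′ k k′ → h ℕ.+ h′ ≡ a → k ℕ.+ k′ ≡ a → walks a k n h ≡ walks a k′ n h′
walks-reflect a zero h h′ k k′ hh′ kk′ = δ-reflect h h′ k k′ hh′ kk′
walks-reflect a (suc n) h h′ k k′ hh′ kk′ =
  ≡.trans (cong₂ ℤ._+_ (up≡down-reflect a h h′ (walks a k n) (walks a k′ n) hh′ IH)
                       (≡.sym (up≡down-reflect a h′ h (walks a k′ n) (walks a k n)
                                 (≡.trans (ℕ.+-comm h′ h) hh′)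
                                 (λ i i′ e → ≡.sym (IH i′ i (≡.trans (ℕ.+-comm i′ i) e))))))
          (ℤ.+-comm (down (walks a k′ n) h′) (up a (walks a k′ n) h′))
  where
  IH : ∀ i i′ → i ℕ.+ i′ ≡ a → walks a k n i ≡ walks a k′ n i′
  IH i i′ e = walks-reflect a n i i′ k k′ e kk′

W-from-top : ∀ a k → W (suc a) (suc a) k Z.≈ Zₛ.const (δ (suc a) k) Z.+ 𝕫 Z.* W (suc a) a k
W-from-top a k zero = ≡.sym (≡.trans (cong (ℤ._+_ (δ (suc a) k)) (Zₛ.X⊛-zero (W (suc a) a k))) (ℤ.+-identityʳ _))
W-from-top a k (suc n) = ≡.trans (cong (ℤ._+ walks (suc a) k n a) (up-≥ {suc a} {suc a} (walks (suc a) k n) ℕ.≤-refl))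
  (cong (ℤ._+_ (+ 0)) (≡.sym (Zₛ.X⊛-suc (W (suc a) a k) n)))


count : (List Step → Bool) → ℕ → ℕ
count Q zero = if Q [] then 1 else 0
count Q (suc n) = count (λ w → Q (u ∷ w)) n ℕ.+ count (λ w → Q (d ∷ w)) n

length-filter-map : ∀ (Q : List Step → Bool) (f : List Step → List Step) ws →
  length (filter (λ w → T? (Q w)) (map f ws)) ≡ length (filter (λ w → T? (Q (f w))) ws)
length-filter-map Q f [] = refl
length-filter-map Q f (w ∷ ws) with Q (f w)
... | true = cong suc (length-filter-map Q f ws)
... | false = length-filter-map Q f ws

length-filter-words : ∀ Q n → length (filter (λ w → T? (Q w)) (words n)) ≡ count Q n
length-filter-words Q zero with Q []
... | true = refl
... | false = refl
length-filter-words Q (suc n) = begin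
  length (filter Q? (map (u ∷_) (words n) ++ map (d ∷_) (words n)))
    ≡⟨ cong length (List.filter-++ Q? (map (u ∷_) (words n)) (map (d ∷_) (words n))) ⟩
  length (filter Q? (map (u ∷_) (words n)) ++ filter Q? (map (d ∷_) (words n)))
    ≡⟨ List.length-++ (filter Q? (map (u ∷_) (words n))) {filter Q? (map (d ∷_) (words n))} ⟩
  length (filter Q? (map (u ∷_) (words n))) ℕ.+ length (filter Q? (map (d ∷_) (words n)))
    ≡⟨ cong₂ ℕ._+_ (≡.trans (length-filter-map Q (u ∷_) (words n)) (length-filter-words (λ w → Q (u ∷ w)) n))
                   (≡.trans (length-filter-map Q (d ∷_) (words n)) (length-filter-words (λ w → Q (d ∷ w)) n)) ⟩
  count Q (suc n) ∎
  where
  open ≡.≡-Reasoning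
  Q? : (w : List Step) → Dec (T (Q w))
  Q? w = T? (Q w)

count-cong : ∀ {Q Q′} → (∀ w → Q w ≡ Q′ w) → ∀ n → count Q n ≡ count Q′ n
count-cong Q≡Q′ zero = cong (λ b → if b then 1 else 0) (Q≡Q′ [])
count-cong Q≡Q′ (suc n) = cong₂ ℕ._+_ (count-cong (λ w → Q≡Q′ (u ∷ w)) n) (count-cong (λ w → Q≡Q′ (d ∷ w)) n)

count-false : ∀ {Q} → (∀ w → Q w ≡ false) → ∀ n → count Q n ≡ 0
count-false Q≡false n = ≡.trans (count-cong Q≡false n) (none n)
  where
  none : ∀ n → count (λ _ → false) n ≡ 0
  none zero = refl
  none (suc n) = cong₂ ℕ._+_ (none n) (none n)

-- slrFrom recognises a peak as the pattern u ∷ d; slr′ reads one step at a time and remembers in p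
-- whether the previous step was u.
slr′ : Bool → ℕ → ℕ → List Step → ℕ
slr′ p h m [] = 0
slr′ p h m (u ∷ s) = slr′ true (suc h) m s
slr′ false h m (d ∷ s) = slr′ false (h ∸ 1) m s
slr′ true h m (d ∷ s) = if m <ᵇ h then suc (slr′ false (h ∸ 1) h s) else slr′ false (h ∸ 1) m s

slrFrom≡slr′ : ∀ h m w → slrFrom h m w ≡ slr′ false h m w
slrFrom≡slr′ h m [] = refl
slrFrom≡slr′ h m (d ∷ w) = slrFrom≡slr′ (h ∸ 1) m w
slrFrom≡slr′ h m (u ∷ []) = refl
slrFrom≡slr′ h m (u ∷ u ∷ w) = slrFrom≡slr′ (suc h) m (u ∷ w)
slrFrom≡slr′ h m (u ∷ d ∷ w) with m <ᵇ suc h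
... | true = cong suc (slrFrom≡slr′ h (suc h) w)
... | false = slrFrom≡slr′ h m w

slr′-flag-irrelevant : ∀ h m w → h ≤ m → slr′ true h m w ≡ slr′ false h m w
slr′-flag-irrelevant h m [] _ = refl
slr′-flag-irrelevant h m (u ∷ w) _ = refl
slr′-flag-irrelevant h m (d ∷ w) h≤m with m <ᵇ h | ℕ.<ᵇ⇒< m h
... | true | m<h = ⊥-elim (ℕ.≤⇒≯ h≤m (m<h _))
... | false | _ = refl

maxFrom-≥ : ∀ h w → h ≤ maxFrom h w
maxFrom-≥ h [] = ℕ.≤-refl
maxFrom-≥ h (u ∷ w) = ℕ.m≤m⊔n h _
maxFrom-≥ h (d ∷ w) = ℕ.m≤m⊔n h _

factor : ℕ → XZSeries
factor h = XZ.1# XZ.+ 𝕩 XZ.* (↑ (A h) XZ.- XZ.1#)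

∏ : ℕ → ℕ → (ℕ → XZSeries) → XZSeries
∏ a zero f = XZ.1#
∏ a (suc k) f = f a XZ.* ∏ (suc a) k f

↑zPow-zero : ↑ (zPow 0) XZ.≈ XZ.1#
↑zPow-zero = XZ.trans {↑ (zPow 0)} (XZₛ.const-cong zPow-zero) XZₛ.const-1

↑zPow-suc : ∀ k → ↑ (zPow (suc k)) XZ.≈ ↑ 𝕫 XZ.* ↑ (zPow k)
↑zPow-suc k = XZ.trans {↑ (zPow (suc k))} (XZₛ.const-cong (zPow-suc k)) (XZₛ.const-* 𝕫 (zPow k))

↑A-1≈↑𝕫*↑W : ∀ j → ↑ (A (suc j)) XZ.- XZ.1# XZ.≈ ↑ 𝕫 XZ.* ↑ (W (suc j) j (suc j))
↑A-1≈↑𝕫*↑W j = begin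
  ↑ (A (suc j)) XZ.- XZ.1#
    ≈⟨ XZ.+-congʳ {XZ.- XZ.1#} (XZₛ.const-cong {A (suc j)} (Z.trans {A (suc j)} (A≈W (suc j)) (W-from-top j (suc j)))) ⟩
  ↑ (Zₛ.const (δ (suc j) (suc j)) Z.+ 𝕫 Z.* w) XZ.- XZ.1#
    ≈⟨ XZ.+-congʳ {XZ.- XZ.1#} (XZ.trans {↑ (Zₛ.const (δ (suc j) (suc j)) Z.+ 𝕫 Z.* w)}
         (XZₛ.const-+ (Zₛ.const (δ (suc j) (suc j))) (𝕫 Z.* w))
         (XZ.+-cong {↑ (Zₛ.const (δ (suc j) (suc j)))} (XZₛ.const-cong {Zₛ.const (δ (suc j) (suc j))}
            (Z.trans {Zₛ.const (δ (suc j) (suc j))} (Zₛ.const-cong (δ-refl (suc j))) Zₛ.const-1))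
            (XZₛ.const-* 𝕫 w))) ⟩
  (↑ Z.1# XZ.+ ↑ 𝕫 XZ.* ↑ w) XZ.- XZ.1#
    ≈⟨ XZ.+-congʳ {XZ.- XZ.1#} (XZ.+-congʳ {↑ 𝕫 XZ.* ↑ w} XZₛ.const-1) ⟩
  (XZ.1# XZ.+ ↑ 𝕫 XZ.* ↑ w) XZ.- XZ.1#
    ≈⟨ xyx⁻¹≈y XZ.1# (↑ 𝕫 XZ.* ↑ w) ⟩
  ↑ 𝕫 XZ.* ↑ w ∎
  where
  open SetoidReasoning XZ.setoid
  open AbelianGroupProperties XZ.+-abelianGroup using (xyx⁻¹≈y)
  w = W (suc j) j (suc j)

C≈𝕫*W : ∀ r′ → C (suc r′) Z.≈ 𝕫 Z.* W (suc r′) r′ 0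
C≈𝕫*W r′ = begin
  C r                                           ≈⟨ C≈W r ⟩
  W r 0 r                                       ≈⟨ (λ n → walks-reflect r n 0 r r 0 refl (ℕ.+-identityʳ r)) ⟩
  W r r 0                                       ≈⟨ W-from-top r′ 0 ⟩
  Zₛ.const (+ 0) Z.+ 𝕫 Z.* W r r′ 0             ≈⟨ Z.+-congʳ {𝕫 Z.* W r r′ 0} Zₛ.const-0 ⟩
  Z.0# Z.+ 𝕫 Z.* W r r′ 0                       ≈⟨ Z.+-identityˡ _ ⟩
  𝕫 Z.* W r r′ 0                                ∎
  where
  open SetoidReasoning Z.setoid
  r = suc r′

module XZSolver = NaturalCoefficientSolver XZ.commutativeSemiring

-- The first-visit decomposition of Dyck paths

module Decomposition (r′ : ℕ) where

  r : ℕ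
  r = suc r′

  -- Appending w to a prefix that ends at height h, with an up step iff p, whose highest point has
  -- height M and whose highest peak has height m (0 if it has none), gives a Dyck path of height r
  -- in which w contributes i strict left-to-right maxima.
  completes : Bool → ℕ → ℕ → ℕ → ℕ → List Step → Bool
  completes p h M m i w = dyckFrom h w ∧ ((M ⊔ maxFrom h w) ≡ᵇ r) ∧ (slr′ p h m w ≡ᵇ i)

  Completions : Bool → ℕ → ℕ → ℕ → XZSeries
  Completions p h M m i n = + count (completes p h M m i) n

  -- Completions right after the first arrival at height j + 1 (with highest peak m < j + 1), at
  -- height h ≤ j after a record peak of height j (as a function of h, for a fixed power x^i),
  -- and right after a record peak of height j + 1.
  E : ℕ → ℕ → XZSeries
  E j m = Completions true (suc j) j m

  Below : ℕ → ℕ → ℕ → ZSeries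
  Below j i h = Completions false h j j i

  AfterRecord : ℕ → XZSeries
  AfterRecord j = Completions false j (suc j) (suc j)

  completes-u : ∀ p h M m i w → completes p h M m i (u ∷ w) ≡ completes true (suc h) (M ⊔ h) m i w
  completes-u p h M m i w = cong (λ t → dyckFrom (suc h) w ∧ (t ≡ᵇ r) ∧ (slr′ true (suc h) m w ≡ᵇ i))
    (≡.sym (ℕ.⊔-assoc M h (maxFrom (suc h) w)))

  completes-d : ∀ h M m i w → completes false (suc h) M m i (d ∷ w) ≡ completes false h (M ⊔ suc h) m i w
  completes-d h M m i w = cong (λ t → dyckFrom h w ∧ (t ≡ᵇ r) ∧ (slr′ false h m w ≡ᵇ i))
    (≡.sym (ℕ.⊔-assoc M (suc h) (maxFrom h w)))

  completes-record : ∀ h M m i w → m < suc h →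
    completes true (suc h) M m (suc i) (d ∷ w) ≡ completes false h (M ⊔ suc h) (suc h) i w
  completes-record h M m i w m<h with m <ᵇ suc h | ℕ.<⇒<ᵇ m<h
  ... | true | _ = cong (λ t → dyckFrom h w ∧ (t ≡ᵇ r) ∧ (slr′ false h (suc h) w ≡ᵇ i))
    (≡.sym (ℕ.⊔-assoc M (suc h) (maxFrom h w)))

  completes-record-zero : ∀ h M m w → m < suc h → completes true (suc h) M m 0 (d ∷ w) ≡ false
  completes-record-zero h M m w m<h with m <ᵇ suc h | ℕ.<⇒<ᵇ m<h
  ... | true | _ = ≡.trans (cong (dyckFrom h w ∧_) (∧-zeroʳ _)) (∧-zeroʳ _)

  completes-too-high : ∀ p h M m i w → r < h → completes p h M m i w ≡ false
  completes-too-high p h M m i w r<h =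
    ≡.trans (cong (λ b → dyckFrom h w ∧ b ∧ (slr′ p h m w ≡ᵇ i))
              (≡ᵇ-≢ (ℕ.>⇒≢ (ℕ.<-≤-trans r<h (ℕ.≤-trans (maxFrom-≥ h w) (ℕ.m≤n⊔m M _))))))
            (∧-zeroʳ _)

  completes-flag-irrelevant : ∀ h M m i w → h ≤ m → completes true h M m i w ≡ completes false h M m i w
  completes-flag-irrelevant h M m i w h≤m = cong (λ s → dyckFrom h w ∧ ((M ⊔ maxFrom h w) ≡ᵇ r) ∧ (s ≡ᵇ i))
    (slr′-flag-irrelevant h m w h≤m)

  completes-[]-low : ∀ p h M m i → M < r → h ≤ M → completes p h M m i [] ≡ false
  completes-[]-low p h M m i M<r h≤M =
    ≡.trans (cong (λ t → (h ≡ᵇ 0) ∧ (t ≡ᵇ r) ∧ (0 ≡ᵇ i)) (ℕ.m≥n⇒m⊔n≡m h≤M))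
      (≡.trans (cong (λ b → (h ≡ᵇ 0) ∧ b ∧ (0 ≡ᵇ i)) (≡ᵇ-≢ (ℕ.<⇒≢ M<r))) (∧-zeroʳ _))

  up-part : ∀ j h i n → h < j →
    count (λ w → completes false h j j i (u ∷ w)) n ≡ count (completes false (suc h) j j i) n
  up-part j h i n h<j = ≡.trans (count-cong (completes-u false h j j i) n)
    (≡.trans (cong (λ M → count (completes true (suc h) M j i) n) (ℕ.m≥n⇒m⊔n≡m (ℕ.<⇒≤ h<j)))
      (count-cong (λ w → completes-flag-irrelevant (suc h) j j i w h<j) n))

  up-part-top : ∀ j i n → count (λ w → completes false j j j i (u ∷ w)) n ≡ count (completes true (suc j) j j i) n
  up-part-top j i n = ≡.trans (count-cong (completes-u false j j j i) n)
    (cong (λ M → count (completes true (suc j) M j i) n) (ℕ.⊔-idem j))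

  down-part : ∀ j h i n → h ≤ j →
    + count (λ w → completes false h j j i (d ∷ w)) n ≡ down (λ h′ → Below j i h′ n) h
  down-part j zero i n _ = cong +_ (count-false (λ w → refl) n)
  down-part j (suc h) i n h≤j = cong +_ (≡.trans (count-cong (completes-d h j j i) n)
    (cong (λ M → count (completes false h M j i) n) (ℕ.m≥n⇒m⊔n≡m h≤j)))

  Below-suc : ∀ j i h n → h ≤ j → Below j i h (suc n) ≡
    δ h j ℤ.* + count (completes true (suc j) j j i) n ℤ.+ neighbours j (λ h′ → Below j i h′ n) h
  Below-suc j i h n h≤j with ℕ.m≤n⇒m<n∨m≡n h≤j
  ... | inj₁ h<j = begin
    + count (λ w → completes false h j j i (u ∷ w)) n ℤ.+ + count (λ w → completes false h j j i (d ∷ w)) n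
      ≡⟨ cong₂ ℤ._+_ (≡.trans (cong +_ (up-part j h i n h<j)) (≡.sym (up-< (λ h′ → Below j i h′ n) h<j)))
                     (down-part j h i n h≤j) ⟩
    neighbours j (λ h′ → Below j i h′ n) h
      ≡⟨ ℤ.+-identityˡ _ ⟨
    + 0 ℤ.+ neighbours j (λ h′ → Below j i h′ n) h
      ≡⟨ cong (ℤ._+ neighbours j (λ h′ → Below j i h′ n) h)
           (≡.trans (cong (ℤ._* c) (δ-≢ (ℕ.<⇒≢ h<j))) (ℤ.*-zeroˡ c)) ⟨
    δ h j ℤ.* c ℤ.+ neighbours j (λ h′ → Below j i h′ n) h ∎
    where
    open ≡.≡-Reasoning
    c = + count (completes true (suc j) j j i) n
  ... | inj₂ refl = begin
    + count (λ w → completes false h h h i (u ∷ w)) n ℤ.+ + count (λ w → completes false h h h i (d ∷ w)) n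
      ≡⟨ cong₂ ℤ._+_ (cong +_ (up-part-top h i n)) (down-part h h i n h≤j) ⟩
    c ℤ.+ down (λ h′ → Below h i h′ n) h
      ≡⟨ cong₂ ℤ._+_ (≡.trans (cong (ℤ._* c) (δ-refl h)) (ℤ.*-identityˡ c))
                     (≡.trans (cong (ℤ._+ down (λ h′ → Below h i h′ n) h) (up-≥ {h} {h} (λ h′ → Below h i h′ n) ℕ.≤-refl))
                              (ℤ.+-identityˡ (down (λ h′ → Below h i h′ n) h))) ⟨
    δ h h ℤ.* c ℤ.+ neighbours h (λ h′ → Below h i h′ n) h ∎
    where
    open ≡.≡-Reasoning
    c = + count (completes true (suc h) h h i) n

  Below-system : ∀ j i → j < r → StripSystem j j (𝕫 Z.* E j j i) (Below j i)
  Below-system j i j<r h h≤j =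
    ≡.trans (cong (λ b → + (if b then 1 else 0)) (completes-[]-low false h j j i j<r h≤j))
      (≡.sym (≡.trans (cong (δ h j ℤ.*_) (Zₛ.X⊛-zero (E j j i))) (ℤ.*-zeroʳ (δ h j)))) ,
    λ n → ≡.trans (Below-suc j i h n h≤j)
      (cong (λ t → δ h j ℤ.* t ℤ.+ neighbours j (λ h′ → Below j i h′ n) h) (≡.sym (Zₛ.X⊛-suc (E j j i) n)))

  Below-top-system : ∀ i → StripSystem r 0 (XZ.1# i) (Below r i)
  Below-top-system i h h≤r = at-zero h i , λ n → ≡.trans (Below-suc r i h n h≤r)
      (cong (ℤ._+ neighbours r (λ h′ → Below r i h′ n) h) (≡.trans
        (cong (λ c → δ h r ℤ.* + c) (count-false (λ w → completes-too-high true (suc r) r r i w ℕ.≤-refl) n))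
        (≡.trans (ℤ.*-zeroʳ (δ h r)) (≡.sym (≡.trans (cong (δ h 0 ℤ.*_) (1#-suc i n)) (ℤ.*-zeroʳ (δ h 0)))))))
    where
    1#-suc : ∀ i n → XZ.1# i (suc n) ≡ + 0
    1#-suc zero n = refl
    1#-suc (suc i) n = refl
    at-zero : ∀ h i → Below r i h 0 ≡ δ h 0 ℤ.* XZ.1# i 0
    at-zero zero zero rewrite ≡ᵇ-refl r′ = refl
    at-zero zero (suc i) rewrite ≡ᵇ-refl r′ = refl
    at-zero (suc h) i = refl

  Below≈W : ∀ j i → j < r → ∀ h → h ≤ j → Below j i h Z.≈ W j h j Z.* (𝕫 Z.* E j j i)
  Below≈W j i j<r = StripSystem⇒W {b = 𝕫 Z.* E j j i} (Below-system j i j<r)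

  Below-top≈↑W : ∀ i n → Below r i r′ n ≡ ↑ (W r r′ 0) i n
  Below-top≈↑W i n = ≡.trans (StripSystem⇒W {b = XZ.1# i} (Below-top-system i) r′ (ℕ.n≤1+n r′) n)
    (≡.trans (≡.sym (XZₛ.const-⊛ (W r r′ 0) XZ.1# i n)) (XZ.*-identityʳ (↑ (W r r′ 0)) i n))

  E-step : ∀ j m → suc j < r → m ≤ j →
    E j m XZ.≈ ↑ 𝕫 XZ.* E (suc j) m XZ.+ 𝕩 XZ.* (↑ 𝕫 XZ.* AfterRecord j)
  E-step j m sj<r m≤j i zero = ≡.sym (cong₂ ℤ._+_ (↑𝕫*-zero (E (suc j) m) i) (no-constant-term i))
    where
    no-constant-term : ∀ i → (𝕩 XZ.* (↑ 𝕫 XZ.* AfterRecord j)) i 0 ≡ + 0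
    no-constant-term zero = XZₛ.X⊛-zero (↑ 𝕫 XZ.* AfterRecord j) 0
    no-constant-term (suc i) = ≡.trans (XZₛ.X⊛-suc (↑ 𝕫 XZ.* AfterRecord j) i 0) (↑𝕫*-zero (AfterRecord j) i)
  E-step j m sj<r m≤j i (suc n) = cong₂ ℤ._+_ (≡.trans (cong +_ rise) (≡.sym (↑𝕫*-suc (E (suc j) m) i n))) (record-peak i)
    where
    rise : count (λ w → completes true (suc j) j m i (u ∷ w)) n ≡ count (completes true (suc (suc j)) (suc j) m i) n
    rise = ≡.trans (count-cong (completes-u true (suc j) j m i) n)
      (cong (λ M → count (completes true (suc (suc j)) M m i) n) (ℕ.m≤n⇒m⊔n≡n (ℕ.n≤1+n j)))
    record-peak : ∀ i → + count (λ w → completes true (suc j) j m i (d ∷ w)) n ≡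
                  (𝕩 XZ.* (↑ 𝕫 XZ.* AfterRecord j)) i (suc n)
    record-peak zero = ≡.trans (cong +_ (count-false (λ w → completes-record-zero j j m w (ℕ.s≤s m≤j)) n))
      (≡.sym (XZₛ.X⊛-zero (↑ 𝕫 XZ.* AfterRecord j) (suc n)))
    record-peak (suc i) = ≡.trans
      (cong +_ (≡.trans (count-cong (λ w → completes-record j j m i w (ℕ.s≤s m≤j)) n)
        (cong (λ M → count (completes false j M (suc j) i) n) (ℕ.m≤n⇒m⊔n≡n (ℕ.n≤1+n j)))))
      (≡.sym (≡.trans (XZₛ.X⊛-suc (↑ 𝕫 XZ.* AfterRecord j) i (suc n)) (↑𝕫*-suc (AfterRecord j) i n)))

  Φ : XZSeries
  Φ = 𝕩 XZ.* (↑ 𝕫 XZ.* ↑ (W r r′ 0))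

  E-top : ∀ m → m ≤ r′ → E r′ m XZ.≈ Φ
  E-top m m≤r′ i zero = ≡.sym (no-constant-term i)
    where
    no-constant-term : ∀ i → Φ i 0 ≡ + 0
    no-constant-term zero = XZₛ.X⊛-zero (↑ 𝕫 XZ.* ↑ (W r r′ 0)) 0
    no-constant-term (suc i) = ≡.trans (XZₛ.X⊛-suc (↑ 𝕫 XZ.* ↑ (W r r′ 0)) i 0) (↑𝕫*-zero (↑ (W r r′ 0)) i)
  E-top m m≤r′ i (suc n) =
    ≡.trans (cong₂ ℤ._+_ (cong +_ (count-false (λ w → ≡.trans (completes-u true r r′ m i w)
                                       (completes-too-high true (suc r) (r′ ⊔ r) m i w ℕ.≤-refl)) n))
                         (record-peak i))
            (ℤ.+-identityˡ _)
    where
    record-peak : ∀ i → + count (λ w → completes true r r′ m i (d ∷ w)) n ≡ Φ i (suc n)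
    record-peak zero = ≡.trans (cong +_ (count-false (λ w → completes-record-zero r′ r′ m w (ℕ.s≤s m≤r′)) n))
      (≡.sym (XZₛ.X⊛-zero (↑ 𝕫 XZ.* ↑ (W r r′ 0)) (suc n)))
    record-peak (suc i) = begin
      + count (λ w → completes true r r′ m (suc i) (d ∷ w)) n
        ≡⟨ cong +_ (≡.trans (count-cong (λ w → completes-record r′ r′ m i w (ℕ.s≤s m≤r′)) n)
             (cong (λ M → count (completes false r′ M r i) n) (ℕ.m≤n⇒m⊔n≡n (ℕ.n≤1+n r′)))) ⟩
      Below r i r′ n
        ≡⟨ Below-top≈↑W i n ⟩
      ↑ (W r r′ 0) i n
        ≡⟨ ≡.trans (XZₛ.X⊛-suc (↑ 𝕫 XZ.* ↑ (W r r′ 0)) i (suc n)) (↑𝕫*-suc (↑ (W r r′ 0)) i n) ⟨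
      Φ (suc i) (suc n) ∎
      where open ≡.≡-Reasoning

  slrGF≈↑𝕫*E : slrGF r XZ.≈ ↑ 𝕫 XZ.* E 0 0
  slrGF≈↑𝕫*E i n = ≡.trans (cong +_ (≡.trans (length-filter-words _ n)
      (count-cong (λ w → cong (λ s → dyckFrom 0 w ∧ (maxFrom 0 w ≡ᵇ r) ∧ (s ≡ᵇ i)) (slrFrom≡slr′ 0 0 w)) n)))
    (from-start n)
    where
    from-start : ∀ n → Completions false 0 0 0 i n ≡ (↑ 𝕫 XZ.* E 0 0) i n
    from-start zero = ≡.sym (↑𝕫*-zero (E 0 0) i)
    from-start (suc n) = ≡.trans
      (cong +_ (≡.trans (cong₂ ℕ._+_ (count-cong (completes-u false 0 0 0 i) n) (count-false (λ w → refl) n))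
                        (ℕ.+-identityʳ _)))
      (≡.sym (↑𝕫*-suc (E 0 0) i n))

  AfterRecord≈W : ∀ j → suc j < r →
    AfterRecord j XZ.≈ ↑ (W (suc j) j (suc j)) XZ.* (↑ 𝕫 XZ.* E (suc j) (suc j))
  AfterRecord≈W j sj<r i n = ≡.trans (Below≈W (suc j) i sj<r j (ℕ.n≤1+n j) n)
    (≡.sym (≡.trans (XZₛ.const-⊛ w (↑ 𝕫 XZ.* E (suc j) (suc j)) i n)
                    (Z.*-congˡ {w} (XZₛ.const-⊛ 𝕫 (E (suc j) (suc j)) i) n)))
    where w = W (suc j) j (suc j)

  E-product : ∀ k j m → j ℕ.+ k ≡ r′ → m ≤ j → E j m XZ.≈ ∏ (suc j) k factor XZ.* (↑ (zPow k) XZ.* Φ)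
  E-product zero j m j+0≡r′ m≤j rewrite ℕ.+-identityʳ j | j+0≡r′ = begin
    E r′ m                          ≈⟨ E-top m m≤j ⟩
    Φ                               ≈⟨ XZ.*-identityˡ Φ ⟨
    XZ.1# XZ.* Φ                    ≈⟨ XZ.*-congʳ {Φ} ↑zPow-zero ⟨
    ↑ (zPow 0) XZ.* Φ               ≈⟨ XZ.*-identityˡ _ ⟨
    XZ.1# XZ.* (↑ (zPow 0) XZ.* Φ)  ∎
    where open SetoidReasoning XZ.setoid
  E-product (suc k) j m j+sk≡r′ m≤j = begin
    E j m
      ≈⟨ E-step j m (ℕ.s≤s sj≤r′) m≤j ⟩
    ↑ 𝕫 XZ.* E (suc j) m XZ.+ 𝕩 XZ.* (↑ 𝕫 XZ.* AfterRecord j)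
      ≈⟨ XZ.+-cong {↑ 𝕫 XZ.* E (suc j) m} (XZ.*-congˡ {↑ 𝕫} (E-product k (suc j) m e (ℕ.m≤n⇒m≤1+n m≤j)))
           (XZ.*-congˡ {𝕩} (XZ.*-congˡ {↑ 𝕫} (XZ.trans {AfterRecord j} (AfterRecord≈W j (ℕ.s≤s sj≤r′))
             (XZ.*-congˡ {↑ w} (XZ.*-congˡ {↑ 𝕫} (E-product k (suc j) (suc j) e ℕ.≤-refl)))))) ⟩
    ↑ 𝕫 XZ.* (P XZ.* (↑ (zPow k) XZ.* Φ)) XZ.+ 𝕩 XZ.* (↑ 𝕫 XZ.* (↑ w XZ.* (↑ 𝕫 XZ.* (P XZ.* (↑ (zPow k) XZ.* Φ)))))
      ≈⟨ solve 6 (λ z x w P Zk Φ → z :* (P :* (Zk :* Φ)) :+ x :* (z :* (w :* (z :* (P :* (Zk :* Φ)))))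
                                 := ((con 1 :+ x :* (z :* w)) :* P) :* ((z :* Zk) :* Φ))
           XZ.refl (↑ 𝕫) 𝕩 (↑ w) P (↑ (zPow k)) Φ ⟩
    ((XZ.1# XZ.+ 𝕩 XZ.* (↑ 𝕫 XZ.* ↑ w)) XZ.* P) XZ.* ((↑ 𝕫 XZ.* ↑ (zPow k)) XZ.* Φ)
      ≈⟨ XZ.*-cong {∏ (suc j) (suc k) factor}
           (XZ.*-congʳ {P} (XZ.+-congˡ {XZ.1#} (XZ.*-congˡ {𝕩} (↑A-1≈↑𝕫*↑W j))))
           (XZ.*-congʳ {Φ} (↑zPow-suc k)) ⟨
    ∏ (suc j) (suc k) factor XZ.* (↑ (zPow (suc k)) XZ.* Φ) ∎
    where
    open SetoidReasoning XZ.setoid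
    open XZSolver
    e : suc j ℕ.+ k ≡ r′
    e = ≡.trans (≡.sym (ℕ.+-suc j k)) j+sk≡r′
    sj≤r′ : suc j ≤ r′
    sj≤r′ = ≡.subst (suc j ≤_) e (ℕ.m≤m+n (suc j) k)
    w = W (suc j) j (suc j)
    P = ∏ (suc (suc j)) k factor

  slrGF≈product : slrGF r XZ.≈ ↑ (zPow r) XZ.* (𝕩 XZ.* (↑ (C r) XZ.* ∏ 1 r′ factor))
  slrGF≈product = begin
    slrGF r
      ≈⟨ slrGF≈↑𝕫*E ⟩
    ↑ 𝕫 XZ.* E 0 0
      ≈⟨ XZ.*-congˡ {↑ 𝕫} (E-product r′ 0 0 refl z≤n) ⟩
    ↑ 𝕫 XZ.* (P XZ.* (↑ (zPow r′) XZ.* (𝕩 XZ.* (↑ 𝕫 XZ.* ↑ w))))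
      ≈⟨ solve 5 (λ z P Zk x w → z :* (P :* (Zk :* (x :* (z :* w)))) := (z :* Zk) :* (x :* ((z :* w) :* P)))
           XZ.refl (↑ 𝕫) P (↑ (zPow r′)) 𝕩 (↑ w) ⟩
    (↑ 𝕫 XZ.* ↑ (zPow r′)) XZ.* (𝕩 XZ.* ((↑ 𝕫 XZ.* ↑ w) XZ.* P))
      ≈⟨ XZ.*-cong {↑ (zPow r)} (↑zPow-suc r′)
           (XZ.*-congˡ {𝕩} (XZ.*-congʳ {P} (XZ.trans {↑ (C r)} (XZₛ.const-cong (C≈𝕫*W r′)) (XZₛ.const-* 𝕫 w)))) ⟨
    ↑ (zPow r) XZ.* (𝕩 XZ.* (↑ (C r) XZ.* P)) ∎
    where
    open SetoidReasoning XZ.setoid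
    open XZSolver
    w = W r r′ 0
    P = ∏ 1 r′ factor

rhsGF≈product : ∀ r → rhsGF r XZ.≈ ↑ (zPow r) XZ.* (𝕩 XZ.* (↑ (C r) XZ.* ∏ 1 (r ∸ 1) factor))
rhsGF≈product r =
  *xz-cong (lift≈↑ (zPow r)) (*xz-cong xXZ≈𝕩 (*xz-cong (lift≈↑ (C r)) (prodFrom≈∏ 1 (r ∸ 1))))
  where
  factor′ : ℕ → XZSeries
  factor′ h = oneXZ +xz (xXZ *xz (lift (A h) +xz negXZ oneXZ))
  factor′≈factor : ∀ h → factor′ h XZ.≈ factor h
  factor′≈factor h = XZ.+-cong {oneXZ} oneXZ≈1 (*xz-cong xXZ≈𝕩
    (XZ.+-cong {lift (A h)} (lift≈↑ (A h)) (XZ.-‿cong {oneXZ} oneXZ≈1)))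
  prodFrom≈∏ : ∀ a k → prodFrom a k factor′ XZ.≈ ∏ a k factor
  prodFrom≈∏ a zero = oneXZ≈1
  prodFrom≈∏ a (suc k) = *xz-cong (factor′≈factor a) (prodFrom≈∏ (suc a) k)

theorem1 : (r : ℕ) → r ≥ 1 → (i n : ℕ) → slrGF r i n ≡ rhsGF r i n
theorem1 (suc r′) _ = XZ.trans {slrGF (suc r′)} (Decomposition.slrGF≈product r′)
                                (XZ.sym {rhsGF (suc r′)} (rhsGF≈product (suc r′)))
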